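{- Let $r\geq 3$ be an integer such that an affine plane of order $r$ exists, and let $\mathcal{H}_r=(V\setminus S,E)$ be the hypergraph defined below. Let $\overline{\mathcal{H}_r}$ be the hypergraph on vertex set $V\setminus S$ whose edges are the edges of $\mathcal{H}_r$ of maximum size (equivalently, the edges of maximum weight under the uniform weight assignment, i.e. the edges of size $r$). Then $\overline{\mathcal{H}_r}$ is perturbable.
   Context: An affine plane of order $q$ is a $q$-uniform hypergraph on $q^2$ vertices (points) with $q(q+1)$ edges (lines) such that each pair of distinct vertices lies in exactly one edge; its lines can be partitioned into $q+1$ parallel classes, each consisting of $q$ pairwise disjoint lines covering all points. Definition of $\mathcal{H}_r$: let $\mathcal{G}_r=(V,\mathcal{L})$ be an affine plane of order $r$ with parallel classes $L_1,\dots,L_{r+1}$, and label its points $v_{i,j}$, $i,j\in[r]$, so that $L_1=\{\{v_{i,1},\dots,v_{i,r}\}: i\in[r]\}$ and $L_{r+1}=\{\{v_{1,i},\dots,v_{r,i}\}: i\in[r]\}$. Let $S=\{v_{r,i}: i\in[r-1]\}\cup\{v_{r-1,r}\}$. Then $\mathcal{H}_r$ has vertex set $V\setminus S$ and edge set $E=\{e\setminus S: e\in \mathcal{L}\setminus L_{r+1}\}$. A perturbation on a hypergraph $H=(W,F)$ is a function $p:W\to\mathbb{R}$ with $\sum_{v\in W}p(v)=0$ and $\sum_{v\in e}p(v)<0$ for every $e\in F$; $H$ is perturbable if a perturbation exists. -}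

module Defs where

open import Data.Nat as ℕ using (ℕ; zero; suc; _∸_)
open import Data.Fin as Fin using (Fin; toℕ; fromℕ)
open import Data.Product using (Σ; Σ-syntax; _×_; _,_; proj₁; proj₂)
open import Data.Bool using (Bool; true; false; _∧_; _∨_; not; if_then_else_)
open import Data.List using (List; []; _∷_; filter; cartesianProduct; allFin; length; foldr; map)
open import Data.Rational as ℚ using (ℚ; 0ℚ)
open import Relation.Nullary using (¬_)
open import Relation.Nullary.Decidable using (⌊_⌋)
open import Relation.Binary.PropositionalEquality using (_≡_; _≢_)
open import Function.Bundles using (_⇔_)

select : {V : Set} → (V → Bool) → List V → List V
select P [] = []
select P (x ∷ xs) = if P x then x ∷ select P xs else select P xs

sumℚ : {V : Set} → (V → ℚ) → List V → ℚ
sumℚ p xs = foldr (λ v acc → p v ℚ.+ acc) 0ℚ xs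

-- A finite hypergraph: vertex set given by a duplicate-free list W of
-- vertices, edges indexed by a type E, with decidable (Bool) membership.
-- Only members of W in an edge count (edges are subsets of W).
IsPerturbation : {V : Set} (W : List V) (E : Set) (mem : E → V → Bool)
               → (V → ℚ) → Set
IsPerturbation W E mem p =
  (sumℚ p W ≡ 0ℚ) × ((e : E) → sumℚ p (select (mem e) W) ℚ.< 0ℚ)

Perturbable : {V : Set} (W : List V) (E : Set) (mem : E → V → Bool) → Set
Perturbable {V} W E mem = Σ[ p ∈ (V → ℚ) ] IsPerturbation W E mem p

-- Points v_{i,j} (i,j ∈ [r]) are represented 0-indexed as (i , j) : Fin r × Fin r.
-- Parallel classes L_1 … L_{r+1} are indexed 0-indexed by Fin (suc r);
-- each class c consists of the r lines (c , k), k : Fin r, where the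
-- line (c , k) is the set of points p with cls c p ≡ k.

Point : ℕ → Set
Point r = Fin r × Fin r

allPoints : (r : ℕ) → List (Point r)
allPoints r = cartesianProduct (allFin r) (allFin r)

Line : ℕ → Set
Line r = Fin (suc r) × Fin r

count : {r : ℕ} → (Point r → Bool) → ℕ
count {r} P = length (select P (allPoints r))

record AffinePlane (r : ℕ) : Set where
  field
    cls : Fin (suc r) → Point r → Fin r

  _∈L_ : Point r → Line r → Set
  p ∈L (c , k) = cls c p ≡ k

  memL : Line r → Point r → Bool
  memL (c , k) p = ⌊ cls c p Fin.≟ k ⌋

  field
    uniform : (ℓ : Line r) → count (memL ℓ) ≡ r
    pairs   : (p q : Point r) → p ≢ q →
              Σ[ ℓ ∈ Line r ] ((p ∈L ℓ) × (q ∈L ℓ) ×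
                ((ℓ′ : Line r) → p ∈L ℓ′ → q ∈L ℓ′ → ℓ′ ≡ ℓ))
    rows    : (p q : Point r) → (cls Fin.zero p ≡ cls Fin.zero q) ⇔ (proj₁ p ≡ proj₁ q)
    cols    : (p q : Point r) → (cls (fromℕ r) p ≡ cls (fromℕ r) q) ⇔ (proj₂ p ≡ proj₂ q)

-- S = {v_{r,i} : i ∈ [r-1]} ∪ {v_{r-1,r}}  (1-indexed), i.e. 0-indexed
-- {(r-1 , j) : j < r-1} ∪ {(r-2 , r-1)}.
inS : {r : ℕ} → Point r → Bool
inS {r} (i , j) =
  (⌊ toℕ i ℕ.≟ r ∸ 1 ⌋ ∧ ⌊ toℕ j ℕ.<? r ∸ 1 ⌋)
  ∨ (⌊ toℕ i ℕ.≟ r ∸ 2 ⌋ ∧ ⌊ toℕ j ℕ.≟ r ∸ 1 ⌋)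

HVertices : (r : ℕ) → List (Point r)
HVertices r = select (λ p → not (inS p)) (allPoints r)

module _ {r : ℕ} (G : AffinePlane r) where
  open AffinePlane G

  NotLast : Line r → Set
  NotLast (c , k) = c ≢ fromℕ r

  -- edge e \ S of H_r coming from line ℓ
  memH : Line r → Point r → Bool
  memH ℓ p = memL ℓ p ∧ not (inS p)

  sizeH : Line r → ℕ
  sizeH ℓ = count (memH ℓ)

  IsMaxEdge : Line r → Set
  IsMaxEdge ℓ = NotLast ℓ × ((ℓ′ : Line r) → NotLast ℓ′ → sizeH ℓ′ ℕ.≤ sizeH ℓ)

  HbarEdge : Set
  HbarEdge = Σ[ ℓ ∈ Line r ] IsMaxEdge ℓ

  memHbar : HbarEdge → Point r → Bool
  memHbar (ℓ , _) = memH ℓ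

  HbarPerturbable : Set
  HbarPerturbable = Perturbable (HVertices r) HbarEdge memHbar

-- Weight the points of the last row by a, those of the penultimate row by
-- b and all other points by c, where, with A, B, C the numbers of points of
-- H_r in these three groups, a = -3C, b = 2C and c = 3A - 2B, so that the
-- total weight A a + B b + C c vanishes. Here A = 1 and B = r - 1 ≥ 2, so
-- c < 0. An edge of maximum size has r points, so it comes from a line
-- disjoint from S. A row with this property lies in neither of the last two
-- rows, and its weight is r c < 0. Any other such line meets every row in
-- exactly one point, so its weight is a + b + (r - 2) c ≤ a + b = -C < 0.

module Submission where

open import Defs
open import Data.Nat using (ℕ; _≤_)
open import Data.Nat as ℕ using (zero; suc; s≤s; z≤n; _<_; _+_)
import Data.Nat.Properties as ℕP
open import Data.Fin as Fin using (Fin; toℕ; fromℕ; inject₁; punchOut)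
import Data.Fin.Properties as FinP
open import Data.Bool using (Bool; true; false; _∧_; not)
open import Data.Bool.Properties using (∧-conicalˡ; ∨-identityʳ; not-injective)
open import Data.List using (List; []; _∷_; length)
open import Data.List.Membership.Propositional using (_∈_)
open import Data.List.Membership.Propositional.Properties using (∈-cartesianProduct⁺; ∈-allFin; ∈-length)
open import Data.List.Relation.Unary.Any using (here; there)
open import Data.List.Relation.Unary.All using (All; []; _∷_)
open import Data.List.Relation.Unary.AllPairs using ([]; _∷_)
open import Data.List.Relation.Unary.Unique.Propositional using (Unique)
import Data.List.Relation.Unary.Unique.Propositional.Properties as Unique
open import Data.Product using (∃; _×_; _,_; proj₁; proj₂; map₁)
open import Function.Base using (_∘_)
open import Function.Bundles using (Equivalence)
open import Function.Definitions using (Injective)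
open import Relation.Nullary using (Dec; yes; no; ¬_; contradiction)
open import Relation.Nullary.Decidable using (⌊_⌋; isYes≗does; dec-true; dec-false)
open import Relation.Binary.PropositionalEquality
open import Data.Rational as ℚ using (ℚ; 0ℚ; 1ℚ)
import Data.Rational.Properties as ℚP
open import Data.Rational.Solver using (module +-*-Solver)
open import Algebra.Bundles using (CommutativeMonoid)
open import Algebra.Properties.CommutativeSemigroup
  (CommutativeMonoid.commutativeSemigroup ℚP.+-0-commutativeMonoid) using (x∙yz≈y∙xz)
open +-*-Solver using (solve; _:+_; _:-_; :-_; _:*_; _:=_; con)

⌊⌋-true : ∀ {A : Set} (a? : Dec A) → A → ⌊ a? ⌋ ≡ true
⌊⌋-true a? a = trans (isYes≗does a?) (dec-true a? a)

⌊⌋-false : ∀ {A : Set} (a? : Dec A) → ¬ A → ⌊ a? ⌋ ≡ false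
⌊⌋-false a? ¬a = trans (isYes≗does a?) (dec-false a? ¬a)

⌊⌋-true⇒≢false : ∀ {A : Set} (a? : Dec A) → A → ⌊ a? ⌋ ≢ false
⌊⌋-true⇒≢false a? a isFalse with () ← trans (sym (⌊⌋-true a? a)) isFalse

⌊⌋-true⁻¹ : ∀ {A : Set} (a? : Dec A) → ⌊ a? ⌋ ≡ true → A
⌊⌋-true⁻¹ (yes a) _ = a

⌊⌋-false⁻¹ : ∀ {A : Set} (a? : Dec A) → ⌊ a? ⌋ ≡ false → ¬ A
⌊⌋-false⁻¹ (no ¬a) _ = ¬a

module _ {V : Set} (P : V → Bool) where

  ∈-select⁻ : ∀ xs {v} → v ∈ select P xs → v ∈ xs × P v ≡ true
  ∈-select⁻ (x ∷ xs) m with P x in Px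
  ∈-select⁻ (x ∷ xs) (here refl) | true  = here refl , Px
  ∈-select⁻ (x ∷ xs) (there m)   | true  = map₁ there (∈-select⁻ xs m)
  ∈-select⁻ (x ∷ xs) m           | false = map₁ there (∈-select⁻ xs m)

  ∈-select⁺ : ∀ {xs v} → v ∈ xs → P v ≡ true → v ∈ select P xs
  ∈-select⁺ {x ∷ xs} (here refl) Pv rewrite Pv = here refl
  ∈-select⁺ {x ∷ xs} (there m) Pv with P x
  ... | true  = there (∈-select⁺ m Pv)
  ... | false = ∈-select⁺ m Pv

  All-select : ∀ {Q : V → Set} {xs} → All Q xs → All Q (select P xs)
  All-select {xs = []}     []       = []
  All-select {xs = x ∷ xs} (q ∷ qs) with P x
  ... | true  = q ∷ All-select qs
  ... | false = All-select qs

  select-unique : ∀ {xs} → Unique xs → Unique (select P xs)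
  select-unique {[]}     []       = []
  select-unique {x ∷ xs} (x∉ ∷ u) with P x
  ... | true  = All-select x∉ ∷ select-unique u
  ... | false = select-unique u

module _ {V : Set} (P Q : V → Bool) where

  length-select-∧-≤ : ∀ xs → length (select (λ v → P v ∧ Q v) xs) ≤ length (select P xs)
  length-select-∧-≤ [] = z≤n
  length-select-∧-≤ (x ∷ xs) with P x | Q x
  ... | true  | true  = s≤s (length-select-∧-≤ xs)
  ... | true  | false = ℕP.m≤n⇒m≤1+n (length-select-∧-≤ xs)
  ... | false | _     = length-select-∧-≤ xs

  length-select-∧-≥⇒implies : ∀ xs → length (select P xs) ≤ length (select (λ v → P v ∧ Q v) xs) →
                              ∀ {v} → v ∈ xs → P v ≡ true → Q v ≡ true
  length-select-∧-≥⇒implies (x ∷ xs) ≥ (here refl) Pv rewrite Pv with Q x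
  ... | true  = refl
  ... | false = contradiction (ℕP.≤-trans ≥ (length-select-∧-≤ xs)) ℕP.1+n≰n
  length-select-∧-≥⇒implies (x ∷ xs) ≥ (there m) Pv with P x | Q x
  ... | true  | true  = length-select-∧-≥⇒implies xs (ℕP.≤-pred ≥) m Pv
  ... | true  | false = length-select-∧-≥⇒implies xs (ℕP.≤-trans (ℕP.n≤1+n _) ≥) m Pv
  ... | false | _     = length-select-∧-≥⇒implies xs ≥ m Pv

  implies⇒length-select-∧ : ∀ xs → (∀ {v} → v ∈ xs → P v ≡ true → Q v ≡ true) →
                            length (select (λ v → P v ∧ Q v) xs) ≡ length (select P xs)
  implies⇒length-select-∧ [] _ = refl
  implies⇒length-select-∧ (x ∷ xs) P⇒Q with P x in Px
  ... | false = implies⇒length-select-∧ xs (P⇒Q ∘ there)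
  ... | true rewrite P⇒Q (here refl) Px = cong suc (implies⇒length-select-∧ xs (P⇒Q ∘ there))

module _ {V : Set} where

  unique-constant⇒length≤1 : ∀ {xs : List V} → Unique xs →
                             (∀ {u v} → u ∈ xs → v ∈ xs → u ≡ v) → length xs ≤ 1
  unique-constant⇒length≤1 {[]}         _                 _ = z≤n
  unique-constant⇒length≤1 {x ∷ []}     _                 _ = s≤s z≤n
  unique-constant⇒length≤1 {x ∷ y ∷ zs} ((x≢y ∷ _) ∷ _) eq =
    contradiction (eq (here refl) (there (here refl))) x≢y

  distinct-members⇒length≥2 : ∀ {xs : List V} {u v} → u ∈ xs → v ∈ xs → u ≢ v → 2 ≤ length xs
  distinct-members⇒length≥2 (here refl) (here refl) u≢v = contradiction refl u≢v
  distinct-members⇒length≥2 (here refl) (there m)   _   = s≤s (∈-length m)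
  distinct-members⇒length≥2 (there m)   (here refl) _   = s≤s (∈-length m)
  distinct-members⇒length≥2 (there m)   (there m′)  u≢v =
    ℕP.m≤n⇒m≤1+n (distinct-members⇒length≥2 m m′ u≢v)

  length≥1⇒nonempty : ∀ {xs : List V} → 1 ≤ length xs → ∃ λ v → v ∈ xs
  length≥1⇒nonempty {x ∷ _} _ = x , here refl

toℚ : ℕ → ℚ
toℚ zero    = 0ℚ
toℚ (suc n) = 1ℚ ℚ.+ toℚ n

toℚ-+ : ∀ m n → toℚ (m + n) ≡ toℚ m ℚ.+ toℚ n
toℚ-+ zero    n = sym (ℚP.+-identityˡ _)
toℚ-+ (suc m) n = trans (cong (1ℚ ℚ.+_) (toℚ-+ m n)) (sym (ℚP.+-assoc 1ℚ (toℚ m) (toℚ n)))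

toℚ-nonNegative : ∀ n → 0ℚ ℚ.≤ toℚ n
toℚ-nonNegative zero    = ℚP.≤-refl
toℚ-nonNegative (suc n) = ℚP.+-mono-≤ (ℚP.nonNegative⁻¹ 1ℚ) (toℚ-nonNegative n)

toℚ-mono-< : ∀ {m n} → m < n → toℚ m ℚ.< toℚ n
toℚ-mono-< {zero}  {suc n} _       =
  ℚP.<-≤-trans (ℚP.positive⁻¹ 1ℚ) (ℚP.+-monoʳ-≤ 1ℚ (toℚ-nonNegative n))
toℚ-mono-< {suc m} {suc n} (s≤s h) = ℚP.+-monoʳ-< 1ℚ (toℚ-mono-< h)

toℚ-balance : ∀ A B C → toℚ A ℚ.* ℚ.- toℚ (C + C + C) ℚ.+
                          (toℚ B ℚ.* toℚ (C + C) ℚ.+ toℚ C ℚ.* (toℚ (A + A + A) ℚ.- toℚ (B + B))) ≡ 0ℚ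
toℚ-balance A B C rewrite toℚ-+ (C + C) C | toℚ-+ C C | toℚ-+ (A + A) A | toℚ-+ A A | toℚ-+ B B =
  solve 3 (λ x y z → x :* (:- (z :+ z :+ z)) :+ (y :* (z :+ z) :+ z :* ((x :+ x :+ x) :- (y :+ y)))
                     := con 0ℚ)
          refl (toℚ A) (toℚ B) (toℚ C)

toℚ-3+2 : ∀ C → ℚ.- toℚ (C + C + C) ℚ.+ (toℚ (C + C) ℚ.+ 0ℚ) ≡ ℚ.- toℚ C
toℚ-3+2 C rewrite toℚ-+ (C + C) C | toℚ-+ C C =
  solve 1 (λ z → (:- (z :+ z :+ z)) :+ ((z :+ z) :+ con 0ℚ) := :- z) refl (toℚ C)

module _ {V : Set} (p : V → ℚ) where

  sumℚ-select : ∀ (Q : V → Bool) xs →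
                sumℚ p xs ≡ sumℚ p (select Q xs) ℚ.+ sumℚ p (select (not ∘ Q) xs)
  sumℚ-select Q [] = sym (ℚP.+-identityʳ 0ℚ)
  sumℚ-select Q (x ∷ xs) with Q x
  ... | true  = trans (cong (p x ℚ.+_) (sumℚ-select Q xs)) (sym (ℚP.+-assoc (p x) _ _))
  ... | false = trans (cong (p x ℚ.+_) (sumℚ-select Q xs)) (x∙yz≈y∙xz (p x) (sumℚ p (select Q xs)) _)

  sumℚ-constant : ∀ xs w → (∀ {v} → v ∈ xs → p v ≡ w) → sumℚ p xs ≡ toℚ (length xs) ℚ.* w
  sumℚ-constant []       w _  = sym (ℚP.*-zeroˡ w)
  sumℚ-constant (x ∷ xs) w pw rewrite pw (here refl) | sumℚ-constant xs w (pw ∘ there) =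
    solve 2 (λ w t → w :+ t :* w := (con 1ℚ :+ t) :* w) refl w (toℚ (length xs))

  sumℚ-nonPositive : ∀ xs → (∀ {v} → v ∈ xs → p v ℚ.≤ 0ℚ) → sumℚ p xs ℚ.≤ 0ℚ
  sumℚ-nonPositive []       _  = ℚP.≤-refl
  sumℚ-nonPositive (x ∷ xs) p≤ = ℚP.+-mono-≤ (p≤ (here refl)) (sumℚ-nonPositive xs (p≤ ∘ there))

  sumℚ-constant-nonPositive : ∀ xs {w u} → (∀ {v} → v ∈ xs → p v ≡ w) → w ℚ.≤ 0ℚ → u ∈ xs →
                              sumℚ p xs ℚ.≤ w
  sumℚ-constant-nonPositive (x ∷ xs) {w} pw w≤0 (here refl) = begin
    p x ℚ.+ sumℚ p xs ≤⟨ ℚP.+-monoʳ-≤ (p x) (sumℚ-nonPositive xs (λ m → subst (ℚ._≤ 0ℚ) (sym (pw (there m))) w≤0)) ⟩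
    p x ℚ.+ 0ℚ        ≡⟨ ℚP.+-identityʳ (p x) ⟩
    p x               ≡⟨ pw (here refl) ⟩
    w                 ∎
    where open ℚP.≤-Reasoning
  sumℚ-constant-nonPositive (x ∷ xs) {w} pw w≤0 (there m) = begin
    p x ℚ.+ sumℚ p xs ≤⟨ ℚP.+-mono-≤ (subst (ℚ._≤ 0ℚ) (sym (pw (here refl))) w≤0)
                                    (sumℚ-constant-nonPositive xs (pw ∘ there) w≤0 m) ⟩
    0ℚ ℚ.+ w          ≡⟨ ℚP.+-identityˡ w ⟩
    w                 ∎
    where open ℚP.≤-Reasoning

  sumℚ-length≤1 : ∀ xs {b} → length xs ≤ 1 → (∀ {v} → v ∈ xs → p v ℚ.≤ b) → 0ℚ ℚ.≤ b → sumℚ p xs ℚ.≤ b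
  sumℚ-length≤1 []           _         _  0≤b = 0≤b
  sumℚ-length≤1 (x ∷ [])     _         p≤ _   =
    ℚP.≤-trans (ℚP.≤-reflexive (ℚP.+-identityʳ (p x))) (p≤ (here refl))
  sumℚ-length≤1 (x ∷ _ ∷ _) (s≤s ()) _  _

injective⇒surjective : ∀ {n} {f : Fin n → Fin n} → Injective _≡_ _≡_ f → ∀ k → ∃ λ j → f j ≡ k
injective⇒surjective {suc m} {f} f-inj k with FinP.any? (λ j → f j Fin.≟ k)
... | yes hit = hit
... | no miss = contradiction (FinP.injective⇒≤ g-inj) ℕP.1+n≰n
  where
  -- f misses k, so it factors injectively through Fin m by punching k out
  g : Fin (suc m) → Fin m
  g j = punchOut {i = k} (λ k≡fj → miss (j , sym k≡fj))

  g-inj : Injective _≡_ _≡_ g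
  g-inj {x} {y} =
    f-inj ∘ FinP.punchOut-injective (λ k≡fx → miss (x , sym k≡fx)) (λ k≡fy → miss (y , sym k≡fy))

module _ {r : ℕ} (G : AffinePlane r) where
  open AffinePlane G

  memL⇒∈L : ∀ {c k v} → memL (c , k) v ≡ true → v ∈L (c , k)
  memL⇒∈L {c} {k} {v} = ⌊⌋-true⁻¹ (cls c v Fin.≟ k)

  ∈L⇒memL : ∀ {c k v} → v ∈L (c , k) → memL (c , k) v ≡ true
  ∈L⇒memL {c} {k} {v} = ⌊⌋-true (cls c v Fin.≟ k)

  sameRow-∈L : ∀ {u v k} → proj₁ u ≡ proj₁ v → u ∈L (Fin.zero , k) → v ∈L (Fin.zero , k)
  sameRow-∈L {u} {v} u~v u∈ = trans (Equivalence.from (rows v u) (sym u~v)) u∈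

  -- The row line through two distinct points of one row is the only line through both.
  sameRow-sameLine⇒rowClass : ∀ {c} u v → u ≢ v → proj₁ u ≡ proj₁ v → cls c u ≡ cls c v → c ≡ Fin.zero
  sameRow-sameLine⇒rowClass {c} u v u≢v u~v same with pairs u v u≢v
  ... | _ , _ , _ , unique = cong proj₁ (trans (unique (c , cls c u) refl (sym same))
                                                (sym (unique (Fin.zero , cls Fin.zero u) refl
                                                             (Equivalence.from (rows v u) (sym u~v)))))

  nonRow-injective : ∀ {c} → c ≢ Fin.zero → ∀ i → Injective _≡_ _≡_ (λ j → cls c (i , j))
  nonRow-injective c≢0 i {j} {j′} same with j Fin.≟ j′
  ... | yes j≡j′ = j≡j′
  ... | no  j≢j′ =
    contradiction (sameRow-sameLine⇒rowClass (i , j) (i , j′) (j≢j′ ∘ cong proj₂) refl same) c≢0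

  nonRow-sameRow⇒≡ : ∀ {c k u v} → c ≢ Fin.zero → proj₁ u ≡ proj₁ v → u ∈L (c , k) → v ∈L (c , k) → u ≡ v
  nonRow-sameRow⇒≡ {u = i , j} {v = .i , j′} c≢0 refl u∈ v∈ =
    cong (i ,_) (nonRow-injective c≢0 i (trans u∈ (sym v∈)))

  nonRow-meets-row : ∀ {c} → c ≢ Fin.zero → ∀ i k → ∃ λ j → (i , j) ∈L (c , k)
  nonRow-meets-row c≢0 i = injective⇒surjective (nonRow-injective c≢0 i)

  full-edge-avoids-S : ∀ ℓ → r ≤ sizeH G ℓ → ∀ v → memL ℓ v ≡ true → inS v ≡ false
  full-edge-avoids-S ℓ full (i , j) v∈ℓ =
    not-injective (length-select-∧-≥⇒implies (memL ℓ) (not ∘ inS) (allPoints r)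
                    (subst (_≤ sizeH G ℓ) (sym (uniform ℓ)) full)
                    (∈-cartesianProduct⁺ (∈-allFin i) (∈-allFin j)) v∈ℓ)

  full-rowEdge-avoids-S : ∀ {k i j} → r ≤ sizeH G (Fin.zero , k) → memL (Fin.zero , k) (i , j) ≡ true →
                          ∀ j′ → inS (i , j′) ≡ false
  full-rowEdge-avoids-S full ij∈ j′ =
    full-edge-avoids-S _ full _ (∈L⇒memL (sameRow-∈L refl (memL⇒∈L ij∈)))

module Weighting (n : ℕ) (G : AffinePlane (3 + n)) where
  open AffinePlane G

  r : ℕ
  r = 3 + n

  last penultimate : Fin r
  last        = fromℕ (2 + n)
  penultimate = inject₁ (fromℕ (1 + n))

  toℕ-last : toℕ last ≡ 2 + n
  toℕ-last = FinP.toℕ-fromℕ (2 + n)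

  toℕ-penultimate : toℕ penultimate ≡ 1 + n
  toℕ-penultimate = trans (FinP.toℕ-inject₁ _) (FinP.toℕ-fromℕ (1 + n))

  inS-lastRow : ∀ {i} j → toℕ i ≡ 2 + n → inS {r} (i , j) ≡ ⌊ toℕ j ℕ.<? 2 + n ⌋
  inS-lastRow {i} j i≡
    rewrite ⌊⌋-true (toℕ i ℕ.≟ 2 + n) i≡
          | ⌊⌋-false (toℕ i ℕ.≟ 1 + n) (ℕP.1+n≢n ∘ trans (sym i≡)) = ∨-identityʳ _

  inS-penultimateRow : ∀ {i} j → toℕ i ≡ 1 + n → inS {r} (i , j) ≡ ⌊ toℕ j ℕ.≟ 2 + n ⌋
  inS-penultimateRow {i} j i≡
    rewrite ⌊⌋-false (toℕ i ℕ.≟ 2 + n) (λ i≡2+n → ℕP.1+n≢n (trans (sym i≡2+n) i≡))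
          | ⌊⌋-true (toℕ i ℕ.≟ 1 + n) i≡ = refl

  onLastRow onPenultimateRow : Point r → Bool
  onLastRow        (i , _) = ⌊ toℕ i ℕ.≟ 2 + n ⌋
  onPenultimateRow (i , _) = ⌊ toℕ i ℕ.≟ 1 + n ⌋

  lastPart offLastPart penultimatePart bodyPart : List (Point r) → List (Point r)
  lastPart        = select onLastRow
  offLastPart     = select (not ∘ onLastRow)
  penultimatePart = select onPenultimateRow ∘ offLastPart
  bodyPart        = select (not ∘ onPenultimateRow) ∘ offLastPart

  sumℚ-parts : ∀ (p : Point r → ℚ) L →
               sumℚ p L ≡ sumℚ p (lastPart L) ℚ.+ (sumℚ p (penultimatePart L) ℚ.+ sumℚ p (bodyPart L))
  sumℚ-parts p L = trans (sumℚ-select p onLastRow L)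
                         (cong (sumℚ p (lastPart L) ℚ.+_)
                               (sumℚ-select p onPenultimateRow (offLastPart L)))

  ∈-offLastPart⁻ : ∀ L {v} → v ∈ offLastPart L → v ∈ L × onLastRow v ≡ false
  ∈-offLastPart⁻ L m = let v∈L , off = ∈-select⁻ (not ∘ onLastRow) L m in v∈L , not-injective off

  ∈-penultimatePart⁻ : ∀ L {v} → v ∈ penultimatePart L →
                       (v ∈ L × onLastRow v ≡ false) × onPenultimateRow v ≡ true
  ∈-penultimatePart⁻ L m = map₁ (∈-offLastPart⁻ L) (∈-select⁻ onPenultimateRow (offLastPart L) m)

  ∈-bodyPart⁻ : ∀ L {v} → v ∈ bodyPart L → (v ∈ L × onLastRow v ≡ false) × onPenultimateRow v ≡ false
  ∈-bodyPart⁻ L m = let m′ , off = ∈-select⁻ (not ∘ onPenultimateRow) (offLastPart L) m in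
                    ∈-offLastPart⁻ L m′ , not-injective off

  H : List (Point r)
  H = HVertices r

  ∈H⁺ : ∀ {v} → inS v ≡ false → v ∈ H
  ∈H⁺ {i , j} ∉S = ∈-select⁺ (not ∘ inS) (∈-cartesianProduct⁺ (∈-allFin i) (∈-allFin j)) (cong not ∉S)

  ∈H⁻ : ∀ {v} → v ∈ H → inS v ≡ false
  ∈H⁻ m = not-injective (proj₂ (∈-select⁻ (not ∘ inS) (allPoints r) m))

  H-unique : Unique H
  H-unique = select-unique (not ∘ inS) (Unique.cartesianProduct⁺ (Unique.allFin⁺ r) (Unique.allFin⁺ r))

  A B C : ℕ
  A = length (lastPart H)
  B = length (penultimatePart H)
  C = length (bodyPart H)

  lastPart-H : ∀ {v} → v ∈ lastPart H → v ≡ (last , last)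
  lastPart-H {i , j} m = cong₂ _,_ (FinP.toℕ-injective (trans i≡ (sym toℕ-last)))
                                   (FinP.toℕ-injective (trans j≡ (sym toℕ-last)))
    where
    i≡ : toℕ i ≡ 2 + n
    i≡ = ⌊⌋-true⁻¹ (toℕ i ℕ.≟ 2 + n) (proj₂ (∈-select⁻ onLastRow H m))
    j≡ : toℕ j ≡ 2 + n
    j≡ = ℕP.≤-antisym (ℕP.≤-pred (FinP.toℕ<n j))
                      (ℕP.≮⇒≥ (⌊⌋-false⁻¹ (toℕ j ℕ.<? 2 + n)
                                          (trans (sym (inS-lastRow j i≡))
                                                 (∈H⁻ (proj₁ (∈-select⁻ onLastRow H m))))))

  A≤1 : A ≤ 1
  A≤1 = unique-constant⇒length≤1 (select-unique onLastRow H-unique)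
                                 (λ u∈ v∈ → trans (lastPart-H u∈) (sym (lastPart-H v∈)))

  penultimate∈ : ∀ j → toℕ j ≢ 2 + n → (penultimate , j) ∈ penultimatePart H
  penultimate∈ j j≢ =
    ∈-select⁺ onPenultimateRow
      (∈-select⁺ (not ∘ onLastRow)
        (∈H⁺ (trans (inS-penultimateRow j toℕ-penultimate) (⌊⌋-false (toℕ j ℕ.≟ 2 + n) j≢)))
        (cong not (⌊⌋-false (toℕ penultimate ℕ.≟ 2 + n)
                            (λ e → ℕP.1+n≢n (trans (sym e) toℕ-penultimate)))))
      (⌊⌋-true (toℕ penultimate ℕ.≟ 1 + n) toℕ-penultimate)

  B≥2 : 2 ≤ B
  B≥2 = distinct-members⇒length≥2 (penultimate∈ Fin.zero (λ ())) (penultimate∈ (Fin.suc Fin.zero) (λ ()))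
                                  (FinP.0≢1+n ∘ cong proj₂)

  C≥1 : 1 ≤ C
  C≥1 = ∈-length (∈-select⁺ (not ∘ onPenultimateRow)
                             (∈-select⁺ (not ∘ onLastRow) (∈H⁺ {Fin.zero , Fin.zero} refl) refl) refl)

  a b c : ℚ
  a = ℚ.- toℚ (C + C + C)
  b = toℚ (C + C)
  c = toℚ (A + A + A) ℚ.- toℚ (B + B)

  a≤0 : a ℚ.≤ 0ℚ
  a≤0 = ℚP.neg-antimono-≤ (toℚ-nonNegative (C + C + C))

  0≤b : 0ℚ ℚ.≤ b
  0≤b = toℚ-nonNegative (C + C)

  c<0 : c ℚ.< 0ℚ
  c<0 = ℚP.<-≤-trans (ℚP.+-monoˡ-< (ℚ.- toℚ (B + B)) (toℚ-mono-< 3A<2B))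
                     (ℚP.≤-reflexive (ℚP.+-inverseʳ (toℚ (B + B))))
    where
    3A<2B : A + A + A < B + B
    3A<2B = ℕP.≤-<-trans (ℕP.+-mono-≤ (ℕP.+-mono-≤ A≤1 A≤1) A≤1) (ℕP.+-mono-≤ B≥2 B≥2)

  c≤0 : c ℚ.≤ 0ℚ
  c≤0 = ℚP.<⇒≤ c<0

  a+b<0 : a ℚ.+ (b ℚ.+ 0ℚ) ℚ.< 0ℚ
  a+b<0 = subst (ℚ._< 0ℚ) (sym (toℚ-3+2 C)) (ℚP.neg-antimono-< (toℚ-mono-< C≥1))

  weightOf : Bool → Bool → ℚ
  weightOf true  _     = a
  weightOf false true  = b
  weightOf false false = c

  weight : Point r → ℚ
  weight v = weightOf (onLastRow v) (onPenultimateRow v)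

  weight-lastPart : ∀ L {v} → v ∈ lastPart L → weight v ≡ a
  weight-lastPart L m = cong₂ weightOf (proj₂ (∈-select⁻ onLastRow L m)) refl

  weight-penultimatePart : ∀ L {v} → v ∈ penultimatePart L → weight v ≡ b
  weight-penultimatePart L m = let (_ , offLast) , onPen = ∈-penultimatePart⁻ L m in
                               cong₂ weightOf offLast onPen

  weight-bodyPart : ∀ L {v} → v ∈ bodyPart L → weight v ≡ c
  weight-bodyPart L m = let (_ , offLast) , offPen = ∈-bodyPart⁻ L m in
                        cong₂ weightOf offLast offPen

  weight-total : sumℚ weight H ≡ 0ℚ
  weight-total = begin
    sumℚ weight H
      ≡⟨ sumℚ-parts weight H ⟩
    sumℚ weight (lastPart H) ℚ.+ (sumℚ weight (penultimatePart H) ℚ.+ sumℚ weight (bodyPart H))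
      ≡⟨ cong₂ ℚ._+_ (sumℚ-constant weight _ a (weight-lastPart H))
                     (cong₂ ℚ._+_ (sumℚ-constant weight _ b (weight-penultimatePart H))
                                  (sumℚ-constant weight _ c (weight-bodyPart H))) ⟩
    toℚ A ℚ.* a ℚ.+ (toℚ B ℚ.* b ℚ.+ toℚ C ℚ.* c)
      ≡⟨ toℚ-balance A B C ⟩
    0ℚ ∎
    where open ≡-Reasoning

  row₀ : Line r
  row₀ = Fin.zero , cls Fin.zero (Fin.zero , Fin.zero)

  sizeH-row₀ : sizeH G row₀ ≡ r
  sizeH-row₀ = trans (implies⇒length-select-∧ (memL row₀) (not ∘ inS) (allPoints r) row₀-avoids-S)
                     (uniform row₀)
    where
    row₀-avoids-S : ∀ {v} → v ∈ allPoints r → memL row₀ v ≡ true → not (inS v) ≡ true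
    row₀-avoids-S {i , j} _ v∈ with Equivalence.to (rows (i , j) (Fin.zero , Fin.zero)) (memL⇒∈L G v∈)
    ... | refl = refl

  maxEdge-full : ∀ {ℓ} → IsMaxEdge G ℓ → r ≤ sizeH G ℓ
  maxEdge-full {ℓ} (_ , maximal) = subst (_≤ sizeH G ℓ) sizeH-row₀ (maximal row₀ (λ ()))

  edgePoints : Line r → List (Point r)
  edgePoints ℓ = select (memH G ℓ) H

  ∈-edgePoints⁺ : ∀ {ℓ v} → r ≤ sizeH G ℓ → memL ℓ v ≡ true → v ∈ edgePoints ℓ
  ∈-edgePoints⁺ {ℓ} {v} full v∈ℓ = ∈-select⁺ (memH G ℓ) (∈H⁺ ∉S) (cong₂ (λ x y → x ∧ not y) v∈ℓ ∉S)
    where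
    ∉S : inS v ≡ false
    ∉S = full-edge-avoids-S G ℓ full v v∈ℓ

  ∈-edgePoints⁻ : ∀ {ℓ v} → v ∈ edgePoints ℓ → memL ℓ v ≡ true
  ∈-edgePoints⁻ {ℓ} m = ∧-conicalˡ _ _ (proj₂ (∈-select⁻ (memH G ℓ) H m))

  full-edge-nonempty : ∀ {ℓ} → r ≤ sizeH G ℓ → ∃ λ v → v ∈ edgePoints ℓ
  full-edge-nonempty {ℓ} full with length≥1⇒nonempty (ℕP.≤-trans (s≤s z≤n) full)
  ... | v , m = v , ∈-edgePoints⁺ full (∧-conicalˡ _ _ (proj₂ (∈-select⁻ (memH G ℓ) (allPoints r) m)))

  -- A full row edge has no point of S in its row, while the last row contains
  -- (last, 0) and the penultimate row contains (penultimate, last).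
  rowEdge-weight : ∀ {k v} → r ≤ sizeH G (Fin.zero , k) → v ∈ edgePoints (Fin.zero , k) → weight v ≡ c
  rowEdge-weight {k} {i , j} full m = cong₂ weightOf (⌊⌋-false (toℕ i ℕ.≟ 2 + n) notLast)
                                                     (⌊⌋-false (toℕ i ℕ.≟ 1 + n) notPenultimate)
    where
    rowAvoidsS : ∀ j′ → inS (i , j′) ≡ false
    rowAvoidsS = full-rowEdge-avoids-S G full (∈-edgePoints⁻ m)
    notLast : toℕ i ≢ 2 + n
    notLast i≡ = contradiction (trans (sym (inS-lastRow Fin.zero i≡)) (rowAvoidsS Fin.zero)) λ ()
    notPenultimate : toℕ i ≢ 1 + n
    notPenultimate i≡ = contradiction (trans (sym (inS-penultimateRow last i≡)) (rowAvoidsS last))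
                                      (⌊⌋-true⇒≢false (toℕ last ℕ.≟ 2 + n) toℕ-last)

  rowEdge-negative : ∀ k → r ≤ sizeH G (Fin.zero , k) → sumℚ weight (edgePoints (Fin.zero , k)) ℚ.< 0ℚ
  rowEdge-negative k full with full-edge-nonempty full
  ... | _ , u∈ = ℚP.≤-<-trans (sumℚ-constant-nonPositive weight _ (rowEdge-weight full) c≤0 u∈) c<0

  nonRowEdge-lastPart : ∀ {c′ k} → r ≤ sizeH G (Fin.suc c′ , k) →
                        sumℚ weight (lastPart (edgePoints (Fin.suc c′ , k))) ℚ.≤ a
  nonRowEdge-lastPart {c′} {k} full with nonRow-meets-row G (λ ()) last k
  ... | _ , onLine =
    sumℚ-constant-nonPositive weight _ (weight-lastPart (edgePoints (Fin.suc c′ , k))) a≤0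
      (∈-select⁺ onLastRow (∈-edgePoints⁺ full (∈L⇒memL G onLine))
                           (⌊⌋-true (toℕ last ℕ.≟ 2 + n) toℕ-last))

  nonRowEdge-penultimatePart : ∀ c′ k → length (penultimatePart (edgePoints (Fin.suc c′ , k))) ≤ 1
  nonRowEdge-penultimatePart c′ k =
    unique-constant⇒length≤1
      (select-unique onPenultimateRow
        (select-unique (not ∘ onLastRow) (select-unique (memH G ℓ) H-unique)))
      (λ u∈ v∈ → nonRow-sameRow⇒≡ G (λ ()) (FinP.toℕ-injective (trans (onRow u∈) (sym (onRow v∈))))
                                   (onLine u∈) (onLine v∈))
    where
    ℓ = Fin.suc c′ , k
    onRow : ∀ {v} → v ∈ penultimatePart (edgePoints ℓ) → toℕ (proj₁ v) ≡ 1 + n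
    onRow {i , _} m = ⌊⌋-true⁻¹ (toℕ i ℕ.≟ 1 + n) (proj₂ (∈-penultimatePart⁻ (edgePoints ℓ) m))
    onLine : ∀ {v} → v ∈ penultimatePart (edgePoints ℓ) → v ∈L ℓ
    onLine m = memL⇒∈L G (∈-edgePoints⁻ (proj₁ (proj₁ (∈-penultimatePart⁻ (edgePoints ℓ) m))))

  nonRowEdge-negative : ∀ c′ k → r ≤ sizeH G (Fin.suc c′ , k) →
                        sumℚ weight (edgePoints (Fin.suc c′ , k)) ℚ.< 0ℚ
  nonRowEdge-negative c′ k full = begin-strict
    sumℚ weight L
      ≡⟨ sumℚ-parts weight L ⟩
    sumℚ weight (lastPart L) ℚ.+ (sumℚ weight (penultimatePart L) ℚ.+ sumℚ weight (bodyPart L))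
      ≤⟨ ℚP.+-mono-≤ (nonRowEdge-lastPart full)
                     (ℚP.+-mono-≤ (sumℚ-length≤1 weight _ (nonRowEdge-penultimatePart c′ k)
                                                 (ℚP.≤-reflexive ∘ weight-penultimatePart L) 0≤b)
                                  (sumℚ-nonPositive weight _
                                     (λ m → ℚP.≤-trans (ℚP.≤-reflexive (weight-bodyPart L m)) c≤0))) ⟩
    a ℚ.+ (b ℚ.+ 0ℚ)
      <⟨ a+b<0 ⟩
    0ℚ ∎
    where
    open ℚP.≤-Reasoning
    L = edgePoints (Fin.suc c′ , k)

  weight-perturbation : IsPerturbation H (HbarEdge G) (memHbar G) weight
  weight-perturbation = weight-total , edgeSum
    where
    edgeSum : (e : HbarEdge G) → sumℚ weight (select (memHbar G e) H) ℚ.< 0ℚ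
    edgeSum ((Fin.zero   , k) , max) = rowEdge-negative k (maxEdge-full max)
    edgeSum ((Fin.suc c′ , k) , max) = nonRowEdge-negative c′ k (maxEdge-full max)

mainTheorem3 : (r : ℕ) → 3 ≤ r → (G : AffinePlane r) → HbarPerturbable G
mainTheorem3 (suc (suc (suc n))) (s≤s (s≤s (s≤s z≤n))) G = weight , weight-perturbation
  where open Weighting n G
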